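{- Let $j\in\mathbb{N}_0$ and let $T$ be a quadtree configuration with $\mathrm{cap}(T) \ge 4^{ -j}$. Then $T$ can be transformed by a sequence of moves into a quadtree configuration $T^*$ that has an empty $j$-pixel.
   Context: The unit square $[0,1]^2$ is recursively subdivided as a quadtree of unbounded depth: the root (layer $0$) is $[0,1]^2$, and every node (pixel) of layer $j$ is an axis-parallel square of side $2^{ -j}$ whose four children are its four quadrants. A pixel of layer $j$ is a $j$-pixel. For $r\in\mathbb{N}_0$, an $r$-square is an axis-parallel square of side $2^{ -r}$. A (quadtree) configuration $T$ assigns finitely many squares to pixels, each $j$-square to a $j$-pixel, at most one square per pixel, such that no pixel with an assigned square is a proper descendant of another pixel with an assigned square. A pixel $p$ contains a square if it is assigned to $p$ or to a descendant of $p$. A pixel with an assigned square is occupied. A non-occupied pixel is blocked if some ancestor is occupied, free otherwise; a free pixel is empty if it contains no square. The capacity $\mathrm{cap}(p)$ of a $j$-pixel $p$ is $0$ if $p$ is occupied or blocked, $4^{ -j}$ if $p$ is empty, and otherwise the sum of the capacities of its four children; $\mathrm{cap}(T)$ is the capacity of the root. A move takes a $j$-square assigned to a $j$-pixel $p$ and reassigns it to a $j$-pixel $q$ that is empty before the move; moves are performed one at a time. -}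

module Defs where

open import Data.Nat using (ℕ; zero; suc)
open import Data.Fin using (Fin; zero; suc)
open import Data.List using (List; []; _∷_; _++_; length)
open import Data.Integer using (+_)
open import Data.Rational using (ℚ; 0ℚ; 1ℚ; _/_; _+_; _*_; _≤_)
open import Data.Product using (Σ; ∃; _×_; _,_)
open import Data.Sum using (_⊎_)
open import Data.Empty using (⊥)
open import Data.Unit using (⊤)
open import Relation.Nullary using (¬_)
open import Relation.Binary.PropositionalEquality using (_≡_; _≢_)
open import Function.Bundles using (_⇔_)

-- A pixel is addressed by the path of quadrant choices from the root;
-- its layer is the length of the path.
Pixel : Set
Pixel = List (Fin 4)

-- A quadtree configuration: a finite quadtree whose leaves are either
-- free with no square ('emptyLeaf') or carry an assigned square ('occLeaf');
-- an inner node's four children are its quadrants.  A square assigned to a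
-- j-pixel is a j-square (its side is determined by its pixel), at most one
-- per pixel, and no occupied pixel is a proper descendant of another.
data Config : Set where
  emptyLeaf : Config
  occLeaf   : Config
  node      : (Fin 4 → Config) → Config

Occupied : Config → Pixel → Set
Occupied emptyLeaf _       = ⊥
Occupied occLeaf   []      = ⊤
Occupied occLeaf   (_ ∷ _) = ⊥
Occupied (node f)  []      = ⊥
Occupied (node f)  (i ∷ p) = Occupied (f i) p

Contains : Config → Pixel → Set
Contains T p = ∃ λ s → Occupied T (p ++ s)

Free : Config → Pixel → Set
Free T p = ¬ Occupied T p × (∀ a i s → p ≡ a ++ (i ∷ s) → ¬ Occupied T a)

Empty : Config → Pixel → Set
Empty T p = Free T p × ¬ Contains T p

quarterPow : ℕ → ℚ
quarterPow zero    = 1ℚ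
quarterPow (suc j) = ((+ 1) / 4) * quarterPow j

-- capacity of the subtree rooted at a j-pixel (j the first argument):
-- empty leaf: 4^{-j}; occupied: 0 (its descendants are blocked, capacity 0);
-- otherwise the sum of the capacities of the four children.
capAt : ℕ → Config → ℚ
capAt j emptyLeaf = quarterPow j
capAt j occLeaf   = 0ℚ
capAt j (node f)  =
  capAt (suc j) (f zero) + (capAt (suc j) (f (suc zero))
    + (capAt (suc j) (f (suc (suc zero))) + capAt (suc j) (f (suc (suc (suc zero))))))

cap : Config → ℚ
cap T = capAt zero T

Move : Config → Config → Set
Move T T' = Σ Pixel λ p → Σ Pixel λ q →
  length p ≡ length q × Occupied T p × Empty T q ×
  (∀ r → Occupied T' r ⇔ ((Occupied T r × r ≢ p) ⊎ r ≡ q))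

module Submission where

-- Fix a layer D ≥ j that lies below all squares.  Capacity then just counts
-- empty pixels: cap T = (number of empty D-pixels) · 4^-D, so the hypothesis
-- says that T has at least 4^(D - j) empty D-pixels; moves do not change this
-- number.  The proof is by induction on the number of squares.  If no square
-- lies deeper than layer j, the j-ancestor of any empty D-pixel is empty.
-- Otherwise remove a deepest square s, of layer L > j.  The rest U has even
-- more empty D-pixels, so by induction a sequence of moves of U produces an
-- empty j-pixel.  This sequence is replayed in T with s carried along as an
-- extra square: when a move targets a pixel q that contains s, a counting
-- argument yields an empty L-pixel outside q, to which s is moved first (and if
-- q is larger than a j-pixel, T already has an empty j-pixel inside q).

open import Defs
open import Data.Nat using (ℕ)
open import Data.List using (length)
open import Data.Rational using (_≤_)
open import Data.Product using (Σ; _×_)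
open import Relation.Binary.PropositionalEquality using (_≡_)
open import Relation.Binary.Construct.Closure.ReflexiveTransitive using (Star)

open import Data.Nat using (zero; suc; _+_; _*_; _∸_; _^_; z≤n; s≤s)
  renaming (_≤_ to _≤ₙ_; _<_ to _<ₙ_; _≤?_ to _≤ₙ?_)
import Data.Nat.Properties as ℕP
open import Data.Fin using (Fin; zero; suc; #_) renaming (_≟_ to _≟ᶠ_)
import Data.Fin.Properties as FinP
open import Data.List using (List; []; _∷_; _++_; map; take; drop; replicate)
import Data.List.Properties as ListP
open import Data.List.Relation.Unary.All using (All; []; _∷_)
import Data.List.Relation.Unary.All as All
import Data.List.Relation.Unary.All.Properties as AllP
open import Data.Product using (_,_; proj₁; proj₂)
open import Data.Sum using (_⊎_; inj₁; inj₂; [_,_])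
open import Data.Sum.Function.Propositional using (_⊎-⇔_)
open import Data.Product.Function.NonDependent.Propositional using (_×-⇔_)
open import Data.Empty using (⊥; ⊥-elim)
open import Data.Unit using (tt)
open import Relation.Nullary using (¬_; Dec; yes; no)
open import Relation.Nullary.Decidable using (map′)
open import Relation.Unary using (Decidable)
open import Relation.Unary.Properties using (_∩?_; _∪?_; ∁?; U?)
open import Relation.Binary.PropositionalEquality
  using (refl; sym; trans; cong; cong₂; subst; subst₂; _≢_; module ≡-Reasoning)
open import Relation.Binary.Construct.Closure.ReflexiveTransitive using (ε; _◅_; _◅◅_)
open import Function.Bundles using (_⇔_; mk⇔; Equivalence)
import Function.Properties.Equivalence as ⇔
open import Data.Vec.Functional using (updateAt)
import Data.Vec.Functional.Properties as VecFP
import Data.Integer as ℤ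
open import Data.Rational using (ℚ; 0ℚ; _/_; Positive)
  renaming (_+_ to _+ℚ_; _*_ to _*ℚ_; _<_ to _<ℚ_)
import Data.Rational.Properties as ℚP
open import Algebra.Bundles using (CommutativeRing)
open import Algebra.Properties.Semiring.Mult (CommutativeRing.semiring ℚP.+-*-commutativeRing)
  using (×-homo-+; ×-assocˡ; ×-assoc-*) renaming (_×_ to _·_)

-- a ⊑ b: the pixel b lies inside the pixel a, i.e. the path a is a prefix of b.
_⊑_ : Pixel → Pixel → Set
a ⊑ b = Σ Pixel λ t → b ≡ a ++ t

⊑-refl : ∀ a → a ⊑ a
⊑-refl a = [] , sym (ListP.++-identityʳ a)

⊑-++ : ∀ a t → a ⊑ (a ++ t)
⊑-++ a t = t , refl

root-⊑ : ∀ b → [] ⊑ b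
root-⊑ b = b , refl

⊑-trans : ∀ {a b c} → a ⊑ b → b ⊑ c → a ⊑ c
⊑-trans {a} (t , refl) (u , refl) = t ++ u , ListP.++-assoc a t u

⊑-cons : ∀ {a b} i → a ⊑ b → (i ∷ a) ⊑ (i ∷ b)
⊑-cons i (t , refl) = t , refl

⊑-uncons : ∀ {a b i k} → (i ∷ a) ⊑ (k ∷ b) → i ≡ k × a ⊑ b
⊑-uncons (t , refl) = refl , (t , refl)

short-suffix : ∀ (a t : Pixel) → length (a ++ t) ≤ₙ length a → t ≡ []
short-suffix a []      _ = refl
short-suffix a (i ∷ t) h = ⊥-elim (ℕP.m+1+n≰m (length a) (subst (_≤ₙ length a) (ListP.length-++ a {i ∷ t}) h))

⊑-flip : ∀ {a b} → a ⊑ b → length b ≤ₙ length a → b ⊑ a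
⊑-flip {a} ([] , refl)    _ = subst (_⊑ a) (sym (ListP.++-identityʳ a)) (⊑-refl a)
⊑-flip {a} (i ∷ t , refl) h with short-suffix a (i ∷ t) h
... | ()

comparable : ∀ {a b c} → a ⊑ c → b ⊑ c → a ⊑ b ⊎ b ⊑ a
comparable {[]}    {b}     _ _ = inj₁ (root-⊑ b)
comparable {i ∷ a} {[]}    _ _ = inj₂ (root-⊑ _)
comparable {i ∷ a} {k ∷ b} {[]}    (_ , ()) _
comparable {i ∷ a} {k ∷ b} {l ∷ c} ac bc with ⊑-uncons {a} {c} ac | ⊑-uncons {b} {c} bc
... | refl , ac′ | refl , bc′ with comparable ac′ bc′
...   | inj₁ ab = inj₁ (⊑-cons i ab)
...   | inj₂ ba = inj₂ (⊑-cons i ba)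

branch-apart : ∀ q {k k′ x y} → k ≢ k′ → ¬ (q ++ k ∷ x) ⊑ (q ++ k′ ∷ y)
branch-apart []      k≢k′ h = k≢k′ (proj₁ (⊑-uncons h))
branch-apart (i ∷ q) k≢k′ h = branch-apart q k≢k′ (proj₂ (⊑-uncons h))

_⊑?_ : ∀ a b → Dec (a ⊑ b)
[]      ⊑? b       = yes (root-⊑ b)
(i ∷ a) ⊑? []      = no λ { (_ , ()) }
(i ∷ a) ⊑? (k ∷ b) with i ≟ᶠ k | a ⊑? b
... | yes refl | yes ab = yes (⊑-cons i ab)
... | yes refl | no ¬ab = no λ h → ¬ab (proj₂ (⊑-uncons h))
... | no i≢k   | _      = no λ h → i≢k (proj₁ (⊑-uncons h))

⊑-length : ∀ {a b} → a ⊑ b → length a ≤ₙ length b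
⊑-length {a} (t , refl) = subst (length a ≤ₙ_) (sym (ListP.length-++ a)) (ℕP.m≤m+n _ _)

take-⊑ : ∀ L (r : Pixel) → take L r ⊑ r
take-⊑ L r = drop L r , sym (ListP.take++drop≡id L r)

length-take : ∀ {L} (r : Pixel) → L ≤ₙ length r → length (take L r) ≡ L
length-take {L} r L≤r = trans (ListP.length-take L r) (ℕP.m≤n⇒m⊓n≡m L≤r)

Disjoint : Pixel → Pixel → Set
Disjoint a b = ¬ a ⊑ b × ¬ b ⊑ a

occupied-antichain : ∀ T {a b} → Occupied T a → Occupied T b → a ⊑ b → a ≡ b
occupied-antichain occLeaf  {[]}    {[]}    _  _  _ = refl
occupied-antichain occLeaf  {[]}    {_ ∷ _} _  () _
occupied-antichain (node f) {i ∷ a} {k ∷ b} oa ob ab with ⊑-uncons ab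
... | refl , ab′ = cong (i ∷_) (occupied-antichain (f i) oa ob ab′)

Bounded : ℕ → Config → Set
Bounded d T = ∀ r → Occupied T r → length r ≤ₙ d

-- Clear T p: no square is assigned to p, to an ancestor of p, or to a
-- descendant of p.  This is 'Empty' with the ancestors of p quantified through
-- the prefix order; it is the form used throughout.
record Clear (T : Config) (p : Pixel) : Set where
  constructor clear
  field
    no-ancestor   : ∀ a → a ⊑ p → ¬ Occupied T a
    no-descendant : ∀ t → ¬ Occupied T (p ++ t)
open Clear

clear⇒empty : ∀ {T p} → Clear T p → Empty T p
clear⇒empty {T} {p} (clear anc desc) =
  (anc p (⊑-refl p) , λ a i s eq → anc a (i ∷ s , eq)) , λ (s , o) → desc s o

empty⇒clear : ∀ {T p} → Empty T p → Clear T p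
empty⇒clear {T} {p} ((¬occ , ¬anc) , ¬contains) = clear anc λ t o → ¬contains (t , o)
  where
  anc : ∀ a → a ⊑ p → ¬ Occupied T a
  anc a ([] , eq)    o = ¬occ (subst (Occupied T) (sym (trans eq (ListP.++-identityʳ a))) o)
  anc a (i ∷ s , eq)   = ¬anc a i s eq

clear-mono : ∀ {T T′ q} → (∀ r → Occupied T′ r → Occupied T r) → Clear T q → Clear T′ q
clear-mono T′⊆T (clear anc desc) = clear (λ a aq o → anc a aq (T′⊆T a o)) λ t o → desc t (T′⊆T _ o)

clear-inside : ∀ {T q r} → Clear T q → q ⊑ r → Clear T r
clear-inside {T} {q} (clear anc desc) (u , refl) =
  clear anc′ λ t o → desc (u ++ t) (subst (Occupied T) (ListP.++-assoc q u t) o)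
  where
  anc′ : ∀ a → a ⊑ (q ++ u) → ¬ Occupied T a
  anc′ a a⊑r with comparable a⊑r (⊑-++ q u)
  ... | inj₁ a⊑q        = anc a a⊑q
  ... | inj₂ (v , refl) = desc v

clear-ancestor : ∀ {V} L r → Bounded L V → Clear V r → L ≤ₙ length r → Clear V (take L r)
clear-ancestor {V} L r bounded (clear anc desc) L≤r = clear (λ b b⊑a → anc b (⊑-trans b⊑a (take-⊑ L r))) desc′
  where
  a = take L r
  desc′ : ∀ t → ¬ Occupied V (a ++ t)
  desc′ t o with short-suffix a t (subst (length (a ++ t) ≤ₙ_) (sym (length-take r L≤r)) (bounded _ o))
  ... | refl = anc a (take-⊑ L r) (subst (Occupied V) (ListP.++-identityʳ a) o)

clear-emptyLeaf : ∀ r → Clear emptyLeaf r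
clear-emptyLeaf r = clear (λ _ _ ()) λ _ ()

clear-occLeaf : ∀ r → ¬ Clear occLeaf r
clear-occLeaf r c = no-ancestor c [] (root-⊑ r) tt

clear-child : ∀ {f i r} → Clear (node f) (i ∷ r) ⇔ Clear (f i) r
clear-child {f} {i} {r} = mk⇔ (λ (clear anc desc) → clear (λ a a⊑r → anc (i ∷ a) (⊑-cons i a⊑r)) desc) from
  where
  from : Clear (f i) r → Clear (node f) (i ∷ r)
  from (clear anc desc) = clear anc′ desc
    where
    anc′ : ∀ a → a ⊑ (i ∷ r) → ¬ Occupied (node f) a
    anc′ []      _ ()
    anc′ (k ∷ a) h with ⊑-uncons h
    ... | refl , a⊑r = anc a a⊑r

clear-root : ∀ {f} → Clear (node f) [] ⇔ (∀ i → Clear (f i) [])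
clear-root {f} = mk⇔ (λ c i → clear (λ a _ o → no-descendant c (i ∷ a) o) λ t o → no-descendant c (i ∷ t) o) from
  where
  from : (∀ i → Clear (f i) []) → Clear (node f) []
  from all-clear = clear anc desc
    where
    anc : ∀ a → a ⊑ [] → ¬ Occupied (node f) a
    anc []      _ ()
    anc (_ ∷ _) (_ , ())
    desc : ∀ t → ¬ Occupied (node f) t
    desc []      ()
    desc (i ∷ t) o = no-descendant (all-clear i) t o

clear? : ∀ T → Decidable (Clear T)
clear? emptyLeaf r       = yes (clear-emptyLeaf r)
clear? occLeaf   r       = no (clear-occLeaf r)
clear? (node f)  (i ∷ r) = map′ (Equivalence.from clear-child) (Equivalence.to clear-child) (clear? (f i) r)
clear? (node f)  []      =
  map′ (Equivalence.from clear-root) (Equivalence.to clear-root) (FinP.all? (λ i → clear? (f i) []))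

count : {A : Set} {P : A → Set} → Decidable P → List A → ℕ
count P? []       = 0
count P? (x ∷ xs) with P? x
... | yes _ = suc (count P? xs)
... | no  _ = count P? xs

module _ {A : Set} {P Q : A → Set} (P? : Decidable P) (Q? : Decidable Q) where

  count-ext : ∀ {G : A → Set} {xs} → All G xs → (∀ {x} → G x → P x ⇔ Q x) → count P? xs ≡ count Q? xs
  count-ext {xs = []}     []         P⇔Q = refl
  count-ext {xs = x ∷ xs} (gx ∷ gxs) P⇔Q with P? x | Q? x
  ... | yes _  | yes _  = cong suc (count-ext gxs P⇔Q)
  ... | no  _  | no  _  = count-ext gxs P⇔Q
  ... | yes px | no ¬qx = ⊥-elim (¬qx (Equivalence.to (P⇔Q gx) px))
  ... | no ¬px | yes qx = ⊥-elim (¬px (Equivalence.from (P⇔Q gx) qx))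

  count-split : ∀ xs → count P? xs ≡ count (P? ∩? Q?) xs + count (P? ∩? ∁? Q?) xs
  count-split []       = refl
  count-split (x ∷ xs) with P? x | Q? x
  ... | yes _ | yes _ = cong suc (count-split xs)
  ... | yes _ | no  _ = trans (cong suc (count-split xs)) (sym (ℕP.+-suc _ _))
  ... | no  _ | yes _ = count-split xs
  ... | no  _ | no  _ = count-split xs

  count-union : (∀ {x} → P x → Q x → ⊥) → ∀ xs → count (P? ∪? Q?) xs ≡ count P? xs + count Q? xs
  count-union disjoint []       = refl
  count-union disjoint (x ∷ xs) with P? x | Q? x
  ... | yes px | yes qx = ⊥-elim (disjoint px qx)
  ... | yes _  | no  _  = cong suc (count-union disjoint xs)
  ... | no  _  | yes _  = trans (cong suc (count-union disjoint xs)) (sym (ℕP.+-suc _ _))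
  ... | no  _  | no  _  = count-union disjoint xs

module _ {A : Set} {P : A → Set} (P? : Decidable P) where

  count-all : (∀ x → P x) → ∀ xs → count P? xs ≡ length xs
  count-all all-P []       = refl
  count-all all-P (x ∷ xs) with P? x
  ... | yes _  = cong suc (count-all all-P xs)
  ... | no ¬px = ⊥-elim (¬px (all-P x))

  count-none : (∀ x → ¬ P x) → ∀ xs → count P? xs ≡ 0
  count-none no-P []       = refl
  count-none no-P (x ∷ xs) with P? x
  ... | yes px = ⊥-elim (no-P x px)
  ... | no  _  = count-none no-P xs

  count≤length : ∀ xs → count P? xs ≤ₙ length xs
  count≤length []       = z≤n
  count≤length (x ∷ xs) with P? x
  ... | yes _ = s≤s (count≤length xs)
  ... | no  _ = ℕP.m≤n⇒m≤1+n (count≤length xs)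

  count-witness : ∀ {G : A → Set} {xs} → All G xs → 0 <ₙ count P? xs → Σ A λ x → P x × G x
  count-witness {xs = x ∷ xs} (gx ∷ gxs) pos with P? x
  ... | yes px = x , px , gx
  ... | no  _  = count-witness gxs pos

  count-++ : ∀ xs ys → count P? (xs ++ ys) ≡ count P? xs + count P? ys
  count-++ []       ys = refl
  count-++ (x ∷ xs) ys with P? x
  ... | yes _ = cong suc (count-++ xs ys)
  ... | no  _ = count-++ xs ys

  count-map : ∀ {B : Set} (g : B → A) xs → count P? (map g xs) ≡ count (λ x → P? (g x)) xs
  count-map g []       = refl
  count-map g (x ∷ xs) with P? (g x)
  ... | yes _ = cong suc (count-map g xs)
  ... | no  _ = count-map g xs

sum4 : (Fin 4 → ℕ) → ℕ
sum4 g = g (# 0) + (g (# 1) + (g (# 2) + g (# 3)))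

sum4-cong : ∀ {g h} → (∀ i → g i ≡ h i) → sum4 g ≡ sum4 h
sum4-cong {g} {h} g≡h
  rewrite g≡h (# 0) | g≡h (# 1) | g≡h (# 2) | g≡h (# 3) = refl

sum4-const : ∀ n → sum4 (λ _ → n) ≡ 4 * n
sum4-const n = cong (λ m → n + (n + (n + m))) (sym (ℕP.+-identityʳ n))

sum4-single : ∀ g k → (∀ i → i ≢ k → g i ≡ 0) → sum4 g ≡ g k
sum4-single g zero                   zero-off
  rewrite zero-off (# 1) (λ ()) | zero-off (# 2) (λ ()) | zero-off (# 3) (λ ()) = ℕP.+-identityʳ _
sum4-single g (suc zero)             zero-off
  rewrite zero-off (# 0) (λ ()) | zero-off (# 2) (λ ()) | zero-off (# 3) (λ ()) = ℕP.+-identityʳ _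
sum4-single g (suc (suc zero))       zero-off
  rewrite zero-off (# 0) (λ ()) | zero-off (# 1) (λ ()) | zero-off (# 3) (λ ()) = ℕP.+-identityʳ _
sum4-single g (suc (suc (suc zero))) zero-off
  rewrite zero-off (# 0) (λ ()) | zero-off (# 1) (λ ()) | zero-off (# 2) (λ ()) = refl

layer : ℕ → List Pixel
layer zero    = [] ∷ []
layer (suc d) = quadrant (# 0) ++ (quadrant (# 1) ++ (quadrant (# 2) ++ quadrant (# 3)))
  where
  quadrant : Fin 4 → List Pixel
  quadrant i = map (i ∷_) (layer d)

layer-length : ∀ d → All (λ x → length x ≡ d) (layer d)
layer-length zero    = refl ∷ []
layer-length (suc d) = AllP.++⁺ (quadrant (# 0)) (AllP.++⁺ (quadrant (# 1)) (AllP.++⁺ (quadrant (# 2)) (quadrant (# 3))))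
  where
  quadrant : ∀ i → All (λ x → length x ≡ suc d) (map (i ∷_) (layer d))
  quadrant i = AllP.map⁺ (All.map (cong suc) (layer-length d))

count-layer-suc : ∀ {P : Pixel → Set} (P? : Decidable P) d →
  count P? (layer (suc d)) ≡ sum4 (λ i → count (λ x → P? (i ∷ x)) (layer d))
count-layer-suc P? d = begin
    count P? (quadrant (# 0) ++ (quadrant (# 1) ++ (quadrant (# 2) ++ quadrant (# 3))))
  ≡⟨ count-++ P? (quadrant (# 0)) _ ⟩
    count P? (quadrant (# 0)) + count P? (quadrant (# 1) ++ (quadrant (# 2) ++ quadrant (# 3)))
  ≡⟨ cong (count P? (quadrant (# 0)) +_) (count-++ P? (quadrant (# 1)) _) ⟩
    count P? (quadrant (# 0)) + (count P? (quadrant (# 1)) + count P? (quadrant (# 2) ++ quadrant (# 3)))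
  ≡⟨ cong (λ m → count P? (quadrant (# 0)) + (count P? (quadrant (# 1)) + m)) (count-++ P? (quadrant (# 2)) _) ⟩
    sum4 (λ i → count P? (quadrant i))
  ≡⟨ sum4-cong (λ i → count-map P? (i ∷_) (layer d)) ⟩
    sum4 (λ i → count (λ x → P? (i ∷ x)) (layer d)) ∎
  where
  open ≡-Reasoning
  quadrant : Fin 4 → List Pixel
  quadrant i = map (i ∷_) (layer d)

count-inside : ∀ q d → length q ≤ₙ d → count (q ⊑?_) (layer d) ≡ 4 ^ (d ∸ length q)
count-inside [] zero    _ = refl
count-inside [] (suc d) _ = begin
    count ([] ⊑?_) (layer (suc d))
  ≡⟨ count-layer-suc ([] ⊑?_) d ⟩
    sum4 (λ i → count (λ x → [] ⊑? (i ∷ x)) (layer d))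
  ≡⟨ sum4-cong (λ i → trans (count-all (λ x → [] ⊑? (i ∷ x)) (λ x → root-⊑ (i ∷ x)) (layer d))
                            (sym (count-all ([] ⊑?_) root-⊑ (layer d)))) ⟩
    sum4 (λ _ → count ([] ⊑?_) (layer d))
  ≡⟨ sum4-const (count ([] ⊑?_) (layer d)) ⟩
    4 * count ([] ⊑?_) (layer d)
  ≡⟨ cong (4 *_) (count-inside [] d z≤n) ⟩
    4 ^ suc d ∎
  where open ≡-Reasoning
count-inside (k ∷ q) (suc d) (s≤s q≤d) = begin
    count ((k ∷ q) ⊑?_) (layer (suc d))
  ≡⟨ count-layer-suc ((k ∷ q) ⊑?_) d ⟩
    sum4 (λ i → count (λ x → (k ∷ q) ⊑? (i ∷ x)) (layer d))
  ≡⟨ sum4-single (λ i → count (λ x → (k ∷ q) ⊑? (i ∷ x)) (layer d)) k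
       (λ i i≢k → count-none (λ x → (k ∷ q) ⊑? (i ∷ x)) (λ x h → i≢k (sym (proj₁ (⊑-uncons h))))
                     (layer d)) ⟩
    count (λ x → (k ∷ q) ⊑? (k ∷ x)) (layer d)
  ≡⟨ count-ext (λ x → (k ∷ q) ⊑? (k ∷ x)) (q ⊑?_) (layer-length d)
       (λ _ → mk⇔ (λ h → proj₂ (⊑-uncons h)) (⊑-cons k)) ⟩
    count (q ⊑?_) (layer d)
  ≡⟨ count-inside q d q≤d ⟩
    4 ^ (d ∸ length q) ∎
  where open ≡-Reasoning

layer-size : ∀ d → length (layer d) ≡ 4 ^ d
layer-size d = trans (sym (count-all ([] ⊑?_) root-⊑ (layer d))) (count-inside [] d z≤n)

emptyCount : ℕ → Config → ℕ
emptyCount d T = count (clear? T) (layer d)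

emptyCount≤ : ∀ d T → emptyCount d T ≤ₙ 4 ^ d
emptyCount≤ d T = subst (emptyCount d T ≤ₙ_) (layer-size d) (count≤length (clear? T) (layer d))

emptyCount-node : ∀ d f → emptyCount (suc d) (node f) ≡ sum4 (λ i → emptyCount d (f i))
emptyCount-node d f = trans (count-layer-suc (clear? (node f)) d)
  (sum4-cong (λ i → count-ext (λ x → clear? (node f) (i ∷ x)) (clear? (f i)) (layer-length d) (λ _ → clear-child)))

-- Capacities are expressed through the n-fold sums  n · x = x + ... + x
-- of the area x of a pixel.
¼ : ℚ
¼ = ℤ.+ 1 / 4

quarterPow-split : ∀ k → quarterPow k ≡ 4 · quarterPow (suc k)
quarterPow-split k = sym (begin
    4 · (¼ *ℚ quarterPow k)  ≡⟨ ×-assoc-* 4 ¼ (quarterPow k) ⟨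
    (4 · ¼) *ℚ quarterPow k  ≡⟨ ℚP.*-identityˡ (quarterPow k) ⟩
    quarterPow k             ∎)
  where open ≡-Reasoning

quarterPow-scale : ∀ k d → quarterPow k ≡ (4 ^ d) · quarterPow (k + d)
quarterPow-scale k zero    = trans (cong quarterPow (sym (ℕP.+-identityʳ k))) (sym (ℚP.+-identityʳ _))
quarterPow-scale k (suc d) = begin
    quarterPow k                              ≡⟨ quarterPow-scale k d ⟩
    (4 ^ d) · quarterPow (k + d)              ≡⟨ cong ((4 ^ d) ·_) (quarterPow-split (k + d)) ⟩
    (4 ^ d) · (4 · quarterPow (suc (k + d)))  ≡⟨ ×-assocˡ _ (4 ^ d) 4 ⟩
    (4 ^ d * 4) · quarterPow (suc (k + d))    ≡⟨ cong₂ _·_ (ℕP.*-comm (4 ^ d) 4)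
                                                            (cong quarterPow (sym (ℕP.+-suc k d))) ⟩
    (4 ^ suc d) · quarterPow (k + suc d)      ∎
  where open ≡-Reasoning

quarterPow-pos : ∀ d → Positive (quarterPow d)
quarterPow-pos zero    = _
quarterPow-pos (suc d) = ℚP.pos*pos⇒pos ¼ (quarterPow d) {{quarterPow-pos d}}

·-sum4 : ∀ g x → sum4 g · x ≡ g (# 0) · x +ℚ (g (# 1) · x +ℚ (g (# 2) · x +ℚ g (# 3) · x))
·-sum4 g x = trans (×-homo-+ x (g (# 0)) _) (cong (g (# 0) · x +ℚ_)
               (trans (×-homo-+ x (g (# 1)) _) (cong (g (# 1) · x +ℚ_) (×-homo-+ x (g (# 2)) _))))

capacity-squarefree : ∀ k T → (∀ r → ¬ Occupied T r) → capAt k T ≡ quarterPow k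
capacity-squarefree k emptyLeaf no-squares = refl
capacity-squarefree k occLeaf   no-squares = ⊥-elim (no-squares [] tt)
capacity-squarefree k (node f)  no-squares = begin
    capAt (suc k) (f (# 0)) +ℚ (capAt (suc k) (f (# 1)) +ℚ (capAt (suc k) (f (# 2)) +ℚ capAt (suc k) (f (# 3))))
  ≡⟨ cong₂ _+ℚ_ (child (# 0)) (cong₂ _+ℚ_ (child (# 1)) (cong₂ _+ℚ_ (child (# 2)) (child (# 3)))) ⟩
    q +ℚ (q +ℚ (q +ℚ q))
  ≡⟨ cong (λ x → q +ℚ (q +ℚ (q +ℚ x))) (sym (ℚP.+-identityʳ q)) ⟩
    4 · q
  ≡⟨ quarterPow-split k ⟨
    quarterPow k ∎
  where
  open ≡-Reasoning
  q = quarterPow (suc k)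
  child : ∀ i → capAt (suc k) (f i) ≡ q
  child i = capacity-squarefree (suc k) (f i) (λ r → no-squares (i ∷ r))

squarefree-count : ∀ d T → (∀ r → ¬ Occupied T r) → emptyCount d T ≡ 4 ^ d
squarefree-count d T no-squares =
  trans (count-all (clear? T) (λ r → clear (λ a _ → no-squares a) λ t → no-squares (r ++ t)) (layer d)) (layer-size d)

capacity-count-squarefree : ∀ d k T → (∀ r → ¬ Occupied T r) → capAt k T ≡ emptyCount d T · quarterPow (k + d)
capacity-count-squarefree d k T no-squares = begin
    capAt k T                              ≡⟨ capacity-squarefree k T no-squares ⟩
    quarterPow k                           ≡⟨ quarterPow-scale k d ⟩
    (4 ^ d) · quarterPow (k + d)           ≡⟨ cong (_· quarterPow (k + d)) (squarefree-count d T no-squares) ⟨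
    emptyCount d T · quarterPow (k + d)    ∎
  where open ≡-Reasoning

capacity-count : ∀ d k T → Bounded d T → capAt k T ≡ emptyCount d T · quarterPow (k + d)
capacity-count d       k emptyLeaf _       = capacity-count-squarefree d k emptyLeaf λ _ ()
capacity-count d       k occLeaf   _       =
  cong (_· quarterPow (k + d)) (sym (count-none (clear? occLeaf) clear-occLeaf (layer d)))
capacity-count zero    k (node f)  bounded = capacity-count-squarefree zero k (node f) no-squares
  where
  no-squares : ∀ r → ¬ Occupied (node f) r
  no-squares (i ∷ r) o with bounded (i ∷ r) o
  ... | ()
capacity-count (suc d) k (node f)  bounded = begin
    capAt (suc k) (f (# 0)) +ℚ (capAt (suc k) (f (# 1)) +ℚ (capAt (suc k) (f (# 2)) +ℚ capAt (suc k) (f (# 3))))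
  ≡⟨ cong₂ _+ℚ_ (child (# 0)) (cong₂ _+ℚ_ (child (# 1)) (cong₂ _+ℚ_ (child (# 2)) (child (# 3)))) ⟩
    e (# 0) · q +ℚ (e (# 1) · q +ℚ (e (# 2) · q +ℚ e (# 3) · q))
  ≡⟨ ·-sum4 e q ⟨
    sum4 e · q
  ≡⟨ cong₂ _·_ (sym (emptyCount-node d f)) (cong quarterPow (sym (ℕP.+-suc k d))) ⟩
    emptyCount (suc d) (node f) · quarterPow (k + suc d) ∎
  where
  open ≡-Reasoning
  q = quarterPow (suc k + d)
  e : Fin 4 → ℕ
  e i = emptyCount d (f i)
  child : ∀ i → capAt (suc k) (f i) ≡ e i · q
  child i = capacity-count d (suc k) (f i) (λ r o → ℕP.≤-pred (bounded (i ∷ r) o))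

·-nonneg : ∀ {x} n → 0ℚ ≤ x → 0ℚ ≤ n · x
·-nonneg zero    _   = ℚP.≤-refl
·-nonneg (suc n) 0≤x = ℚP.+-mono-≤ 0≤x (·-nonneg n 0≤x)

·-strict : ∀ {x} m n → 0ℚ <ℚ x → m <ₙ n → m · x <ℚ n · x
·-strict     zero    (suc n) 0<x _         = ℚP.+-mono-<-≤ 0<x (·-nonneg n (ℚP.<⇒≤ 0<x))
·-strict {x} (suc m) (suc n) 0<x (s≤s m<n) = ℚP.+-monoʳ-< x (·-strict m n 0<x m<n)

·-cancel-≤ : ∀ {x} m n → 0ℚ <ℚ x → m · x ≤ n · x → m ≤ₙ n
·-cancel-≤ m n 0<x le with m ≤ₙ? n
... | yes m≤n = m≤n
... | no  m≰n = ⊥-elim (ℚP.<-irrefl refl (ℚP.<-≤-trans (·-strict n m 0<x (ℕP.≰⇒> m≰n)) le))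

capacity-bound : ∀ j D T → Bounded D T → j ≤ₙ D → quarterPow j ≤ cap T → 4 ^ (D ∸ j) ≤ₙ emptyCount D T
capacity-bound j D T bounded j≤D h =
  ·-cancel-≤ _ _ (ℚP.positive⁻¹ _ {{quarterPow-pos D}}) (subst₂ _≤_ pixel-eq (capacity-count D 0 T bounded) h)
  where
  pixel-eq : quarterPow j ≡ (4 ^ (D ∸ j)) · quarterPow D
  pixel-eq = trans (quarterPow-scale j (D ∸ j)) (cong (λ e → (4 ^ (D ∸ j)) · quarterPow e) (ℕP.m+[n∸m]≡n j≤D))

occupied-updated : ∀ f i (g : Config → Config) r →
  Occupied (node (updateAt f i g)) (i ∷ r) ⇔ Occupied (g (f i)) r
occupied-updated f i g r rewrite VecFP.updateAt-updates i {g} f = ⇔.refl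

occupied-unchanged : ∀ f i (g : Config → Config) k r → k ≢ i →
  Occupied (node (updateAt f i g)) (k ∷ r) ⇔ Occupied (f k) r
occupied-unchanged f i g k r k≢i rewrite VecFP.updateAt-minimal k i {g} f k≢i = ⇔.refl

remove : Config → Pixel → Config
remove emptyLeaf _       = emptyLeaf
remove occLeaf   []      = emptyLeaf
remove occLeaf   (_ ∷ _) = occLeaf
remove (node f)  []      = node f
remove (node f)  (i ∷ p) = node (updateAt f i (λ c → remove c p))

remove-spec : ∀ T p r → Occupied (remove T p) r ⇔ (Occupied T r × r ≢ p)
remove-spec emptyLeaf _       _       = mk⇔ (λ ()) proj₁
remove-spec occLeaf   []      []      = mk⇔ (λ ()) (λ (_ , []≢[]) → []≢[] refl)
remove-spec occLeaf   []      (_ ∷ _) = mk⇔ (λ ()) proj₁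
remove-spec occLeaf   (_ ∷ _) []      = mk⇔ (λ o → o , λ ()) proj₁
remove-spec occLeaf   (_ ∷ _) (_ ∷ _) = mk⇔ (λ ()) proj₁
remove-spec (node f)  []      []      = mk⇔ (λ ()) proj₁
remove-spec (node f)  []      (_ ∷ _) = mk⇔ (λ o → o , λ ()) proj₁
remove-spec (node f)  (_ ∷ _) []      = mk⇔ (λ ()) proj₁
remove-spec (node f)  (i ∷ p) (k ∷ r) with k ≟ᶠ i
... | yes refl = ⇔.trans (occupied-updated f i (λ c → remove c p) r)
                   (⇔.trans (remove-spec (f i) p r)
                     (⇔.refl ×-⇔ mk⇔ (λ r≢p e → r≢p (ListP.∷-injectiveʳ e))
                                     (λ ne e → ne (cong (i ∷_) e))))
... | no  k≢i  = ⇔.trans (occupied-unchanged f i (λ c → remove c p) k r k≢i)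
                   (mk⇔ (λ o → o , λ e → k≢i (ListP.∷-injectiveˡ e)) proj₁)

place : Config → Pixel → Config
place _         []      = occLeaf
place emptyLeaf (i ∷ q) = node (updateAt (λ _ → emptyLeaf) i (λ c → place c q))
place occLeaf   (_ ∷ _) = occLeaf
place (node f)  (i ∷ q) = node (updateAt f i (λ c → place c q))

place-below : ∀ f i q → (∀ r → Occupied (place (f i) q) r ⇔ (Occupied (f i) r ⊎ r ≡ q)) →
  ∀ r → Occupied (node (updateAt f i (λ c → place c q))) r ⇔ (Occupied (node f) r ⊎ r ≡ i ∷ q)
place-below f i q child-spec []      = mk⇔ (λ ()) [ (λ ()) , (λ ()) ]
place-below f i q child-spec (k ∷ r) with k ≟ᶠ i
... | yes refl = ⇔.trans (occupied-updated f i (λ c → place c q) r)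
                   (⇔.trans (child-spec r) (⇔.refl ⊎-⇔ mk⇔ (cong (i ∷_)) ListP.∷-injectiveʳ))
... | no  k≢i  = ⇔.trans (occupied-unchanged f i (λ c → place c q) k r k≢i)
                   (mk⇔ inj₁ [ (λ o → o) , (λ e → ⊥-elim (k≢i (ListP.∷-injectiveˡ e))) ])

place-spec : ∀ U q → Clear U q → ∀ r → Occupied (place U q) r ⇔ (Occupied U r ⊎ r ≡ q)
place-spec U         []      _       []      = mk⇔ (λ _ → inj₂ refl) (λ _ → tt)
place-spec U         []      clear-q (k ∷ r) =
  mk⇔ (λ ()) [ (λ o → ⊥-elim (no-descendant clear-q (k ∷ r) o)) , (λ ()) ]
place-spec occLeaf   (i ∷ q) clear-q _       = ⊥-elim (clear-occLeaf _ clear-q)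
place-spec emptyLeaf (i ∷ q) _       r       =
  ⇔.trans (place-below (λ _ → emptyLeaf) i q (place-spec emptyLeaf q (clear-emptyLeaf q)) r)
          (empty-node r ⊎-⇔ ⇔.refl)
  where
  empty-node : ∀ r → Occupied (node λ _ → emptyLeaf) r ⇔ Occupied emptyLeaf r
  empty-node []      = mk⇔ (λ ()) (λ ())
  empty-node (_ ∷ _) = mk⇔ (λ ()) (λ ())
place-spec (node f)  (i ∷ q) clear-q r       =
  place-below f i q (place-spec (f i) q (Equivalence.to clear-child clear-q)) r

remove-⊆ : ∀ T p r → Occupied (remove T p) r → Occupied T r
remove-⊆ T p r o = proj₁ (Equivalence.to (remove-spec T p r) o)

record Extends (U : Config) (s : Pixel) (V : Config) : Set where
  constructor extends
  field
    extra-clear : Clear U s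
    occupancy   : ∀ r → Occupied V r ⇔ (Occupied U r ⊎ r ≡ s)
open Extends

-- A configuration extends itself with a square removed (the antichain property
-- makes the removed pixel clear).
remove-extends : ∀ T p → Occupied T p → Extends (remove T p) p T
remove-extends T p occ-p = extends (clear anc desc) λ r → mk⇔ (split r) [ remove-⊆ T p r , (λ { refl → occ-p }) ]
  where
  anc : ∀ a → a ⊑ p → ¬ Occupied (remove T p) a
  anc a a⊑p o with Equivalence.to (remove-spec T p a) o
  ... | occ-a , a≢p = a≢p (occupied-antichain T occ-a occ-p a⊑p)
  desc : ∀ t → ¬ Occupied (remove T p) (p ++ t)
  desc t o with Equivalence.to (remove-spec T p (p ++ t)) o
  ... | occ-pt , pt≢p = pt≢p (sym (occupied-antichain T occ-p occ-pt (⊑-++ p t)))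
  split : ∀ r → Occupied T r → Occupied (remove T p) r ⊎ r ≡ p
  split r o with ListP.≡-dec _≟ᶠ_ r p
  ... | yes r≡p = inj₂ r≡p
  ... | no  r≢p = inj₁ (Equivalence.from (remove-spec T p r) (o , r≢p))

extends-occupied : ∀ {U s V} → Extends U s V → Occupied V s
extends-occupied (extends _ V-spec) = Equivalence.from (V-spec _) (inj₂ refl)

extends-⊆ : ∀ {U s V} → Extends U s V → ∀ r → Occupied U r → Occupied V r
extends-⊆ (extends _ V-spec) r o = Equivalence.from (V-spec r) (inj₁ o)

clear-add : ∀ {U V s q} → (∀ r → Occupied V r → Occupied U r ⊎ r ≡ s) → Clear U q → Disjoint q s → Clear V q
clear-add {U} {V} {s} {q} V⊆U+s (clear anc desc) (q⋢s , s⋢q) = clear anc′ desc′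
  where
  anc′ : ∀ a → a ⊑ q → ¬ Occupied V a
  anc′ a a⊑q o with V⊆U+s a o
  ... | inj₁ occ-a = anc a a⊑q occ-a
  ... | inj₂ refl  = s⋢q a⊑q
  desc′ : ∀ t → ¬ Occupied V (q ++ t)
  desc′ t o with V⊆U+s _ o
  ... | inj₁ occ-qt = desc t occ-qt
  ... | inj₂ qt≡s   = q⋢s (t , sym qt≡s)

extends-clear : ∀ {U s V r} → Extends U s V → length s ≤ₙ length r → Clear U r ⇔ (Clear V r ⊎ s ⊑ r)
extends-clear {U} {s} {V} {r} ext@(extends s-clear V-spec) s≤r =
  mk⇔ to [ clear-mono (extends-⊆ ext) , clear-inside s-clear ]
  where
  to : Clear U r → Clear V r ⊎ s ⊑ r
  to clear-r with s ⊑? r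
  ... | yes s⊑r = inj₂ s⊑r
  ... | no  s⋢r =
    inj₁ (clear-add (λ r → Equivalence.to (V-spec r)) clear-r ((λ r⊑s → s⋢r (⊑-flip r⊑s s≤r)) , s⋢r))

extends-count : ∀ {U s V d} {Q : Pixel → Set} (Q? : Decidable Q) → Extends U s V → length s ≤ₙ d →
  (∀ {r} → s ⊑ r → Q r) →
  count (clear? U ∩? Q?) (layer d) ≡ count (clear? V ∩? Q?) (layer d) + 4 ^ (d ∸ length s)
extends-count {U} {s} {V} {d} {Q} Q? ext s≤d inside-Q = begin
    count (clear? U ∩? Q?) (layer d)
  ≡⟨ count-ext (clear? U ∩? Q?) ((clear? V ∩? Q?) ∪? (s ⊑?_)) (layer-length d) split ⟩
    count ((clear? V ∩? Q?) ∪? (s ⊑?_)) (layer d)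
  ≡⟨ count-union (clear? V ∩? Q?) (s ⊑?_)
       (λ (clear-r , _) s⊑r → no-ancestor clear-r s s⊑r (extends-occupied ext)) (layer d) ⟩
    count (clear? V ∩? Q?) (layer d) + count (s ⊑?_) (layer d)
  ≡⟨ cong (count (clear? V ∩? Q?) (layer d) +_) (count-inside s d s≤d) ⟩
    count (clear? V ∩? Q?) (layer d) + 4 ^ (d ∸ length s) ∎
  where
  open ≡-Reasoning
  split : ∀ {r} → length r ≡ d → (Clear U r × Q r) ⇔ ((Clear V r × Q r) ⊎ s ⊑ r)
  split {r} r∈d = mk⇔
    (λ (clear-r , q-r) → [ (λ c → inj₁ (c , q-r)) , inj₂ ] (Equivalence.to clear-U⇔ clear-r))
    [ (λ (c , q-r) → Equivalence.from clear-U⇔ (inj₁ c) , q-r)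
    , (λ s⊑r → Equivalence.from clear-U⇔ (inj₂ s⊑r) , inside-Q s⊑r) ]
    where
    clear-U⇔ : Clear U r ⇔ (Clear V r ⊎ s ⊑ r)
    clear-U⇔ = extends-clear ext (subst (length s ≤ₙ_) (sym r∈d) s≤d)

extends-emptyCount : ∀ {U s V d} → Extends U s V → length s ≤ₙ d →
  emptyCount d U ≡ emptyCount d V + 4 ^ (d ∸ length s)
extends-emptyCount {U} {s} {V} {d} ext s≤d = begin
    emptyCount d U
  ≡⟨ everywhere U ⟩
    count (clear? U ∩? U?) (layer d)
  ≡⟨ extends-count {U} {s} {V} U? ext s≤d _ ⟩
    count (clear? V ∩? U?) (layer d) + 4 ^ (d ∸ length s)
  ≡⟨ cong (_+ 4 ^ (d ∸ length s)) (everywhere V) ⟨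
    emptyCount d V + 4 ^ (d ∸ length s) ∎
  where
  open ≡-Reasoning
  everywhere : ∀ T → emptyCount d T ≡ count (clear? T ∩? U?) (layer d)
  everywhere T = count-ext (clear? T) (clear? T ∩? U?) (layer-length d) (λ _ → mk⇔ (_, tt) proj₁)

remove-gain : ∀ D T s → Occupied T s → length s ≤ₙ D →
  emptyCount D (remove T s) ≡ emptyCount D T + 4 ^ (D ∸ length s)
remove-gain D T s occ-s s≤D = extends-emptyCount {remove T s} {s} {T} (remove-extends T s occ-s) s≤D

moveSquare : Config → Pixel → Pixel → Config
moveSquare T p q = place (remove T p) q

move-spec : ∀ {T p q} → Clear T q → ∀ r → Occupied (moveSquare T p q) r ⇔ ((Occupied T r × r ≢ p) ⊎ r ≡ q)
move-spec {T} {p} {q} clear-q r =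
  ⇔.trans (place-spec (remove T p) q (clear-mono (remove-⊆ T p) clear-q) r) (remove-spec T p r ⊎-⇔ ⇔.refl)

move-valid : ∀ {T p q} → Occupied T p → Clear T q → length p ≡ length q → Move T (moveSquare T p q)
move-valid {T} {p} {q} occ-p clear-q same-layer = p , q , same-layer , occ-p , clear⇒empty clear-q , move-spec clear-q

move-extends : ∀ {T T′} ((p , q , _) : Move T T′) → Extends (remove T p) q T′
move-extends {T} (p , q , _ , _ , empty-q , T′-spec) =
  extends (clear-mono (remove-⊆ T p) (empty⇒clear {T} empty-q))
    λ r → ⇔.trans (T′-spec r) (⇔.sym (remove-spec T p r) ⊎-⇔ ⇔.refl)

move-preserves-count : ∀ d {T T′} → Bounded d T → Move T T′ → emptyCount d T′ ≡ emptyCount d T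
move-preserves-count d {T} {T′} bounded mv@(p , q , same-layer , occ-p , _) =
  ℕP.+-cancelʳ-≡ (4 ^ (d ∸ length q)) _ _ (begin
      emptyCount d T′ + 4 ^ (d ∸ length q)
    ≡⟨ extends-emptyCount {remove T p} {q} {T′} (move-extends {T} {T′} mv) q≤d ⟨
      emptyCount d (remove T p)
    ≡⟨ remove-gain d T p occ-p (bounded p occ-p) ⟩
      emptyCount d T + 4 ^ (d ∸ length p)
    ≡⟨ cong (λ ℓ → emptyCount d T + 4 ^ (d ∸ ℓ)) same-layer ⟩
      emptyCount d T + 4 ^ (d ∸ length q) ∎)
  where
  open ≡-Reasoning
  q≤d : length q ≤ₙ d
  q≤d = subst (_≤ₙ d) same-layer (bounded p occ-p)

ReachesEmpty : ℕ → Config → Set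
ReachesEmpty j V = Σ Config λ V* → Star Move V V* × Σ Pixel λ P → length P ≡ j × Empty V* P

prepend : ∀ {j V V′} → Star Move V V′ → ReachesEmpty j V′ → ReachesEmpty j V
prepend V→V′ (V* , V′→V* , goal) = V* , V→V′ ◅◅ V′→V* , goal

other : Fin 4 → Fin 4
other zero    = # 1
other (suc _) = zero

other≢ : ∀ k → other k ≢ k
other≢ zero    ()
other≢ (suc _) ()

-- Set algebra for a move of p to q performed in the presence of an extra square s ≠ p:
-- ((A ∪ {s}) ∖ {p}) ∪ {q}  =  ((A ∖ {p}) ∪ {q}) ∪ {s}.
move-past : ∀ {A : Set} {r s p q : Pixel} → s ≢ p →
  (((A ⊎ r ≡ s) × r ≢ p) ⊎ r ≡ q) ⇔ (((A × r ≢ p) ⊎ r ≡ q) ⊎ r ≡ s)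
move-past s≢p = mk⇔
  [ (λ { (inj₁ a , r≢p) → inj₁ (inj₁ (a , r≢p)) ; (inj₂ r≡s , _) → inj₂ r≡s })
  , (λ r≡q → inj₁ (inj₂ r≡q)) ]
  [ [ (λ (a , r≢p) → inj₁ (inj₁ a , r≢p)) , inj₂ ] , (λ { refl → inj₁ (inj₂ refl , s≢p) }) ]

-- Any sequence of moves of U that creates an empty
-- j-pixel can be replayed in V, moving the extra square aside when it is in the way.
module Replay (j D L : ℕ) (j<L : j <ₙ L) (L≤D : L ≤ₙ D) where

  record Carries (U : Config) (s : Pixel) (V : Config) : Set where
    constructor carries
    field
      shallow : Bounded L U
      enough  : 4 ^ (D ∸ j) ≤ₙ emptyCount D V
      s-layer : length s ≡ L
      extra   : Extends U s V
  open Carries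

  carries-bounded : ∀ {U s V} → Carries U s V → Bounded L V
  carries-bounded c r o with Equivalence.to (occupancy (extra c) r) o
  ... | inj₁ occ-U = shallow c r occ-U
  ... | inj₂ refl  = ℕP.≤-reflexive (s-layer c)

  V⊆U+s : ∀ {U s V} → Carries U s V → ∀ r → Occupied V r → Occupied U r ⊎ r ≡ s
  V⊆U+s c r = Equivalence.to (occupancy (extra c) r)

  carry-move : ∀ {U s V U′ s′ V′} → Carries U s V → Move V V′ →
    Bounded L U′ → length s′ ≡ L → Extends U′ s′ V′ → Carries U′ s′ V′
  carry-move c mv shallow′ s′-layer ext′ = carries shallow′ enough′ s′-layer ext′
    where
    enough′ = subst (4 ^ (D ∸ j) ≤ₙ_)
      (sym (move-preserves-count D (λ r o → ℕP.≤-trans (carries-bounded c r o) L≤D) mv)) (enough c)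

  -- The empty D-pixels of V inside q are those
  -- of U (all 4^(D - |q|) ≤ 4^(D - j) of them) minus the 4^(D - L) inside s, so
  -- they are fewer than 4^(D - j); the remaining empty D-pixels lie outside q.
  empty-outside : ∀ {U s V q} → Carries U s V → Clear U q → q ⊑ s → j ≤ₙ length q →
    0 <ₙ count (clear? V ∩? ∁? (q ⊑?_)) (layer D)
  empty-outside {U} {s} {V} {q} c clear-q q⊑s j≤q =
    ℕP.<-≤-trans (ℕP.m^n>0 4 (D ∸ length s)) (ℕP.+-cancelˡ-≤ inside _ _
      (ℕP.≤-trans inside+s (subst (4 ^ (D ∸ j) ≤ₙ_) (count-split (clear? V) (q ⊑?_) (layer D)) (enough c))))
    where
    open ≡-Reasoning
    inside : ℕ
    inside = count (clear? V ∩? (q ⊑?_)) (layer D)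
    s≤D : length s ≤ₙ D
    s≤D = subst (_≤ₙ D) (sym (s-layer c)) L≤D
    inside+s : inside + 4 ^ (D ∸ length s) ≤ₙ 4 ^ (D ∸ j)
    inside+s = ℕP.≤-trans (ℕP.≤-reflexive (begin
        inside + 4 ^ (D ∸ length s)            ≡⟨ extends-count (q ⊑?_) (extra c) s≤D (⊑-trans q⊑s) ⟨
        count (clear? U ∩? (q ⊑?_)) (layer D)  ≡⟨ count-ext (clear? U ∩? (q ⊑?_)) (q ⊑?_) (layer-length D)
                                                    (λ _ → mk⇔ proj₂ λ q⊑r → clear-inside clear-q q⊑r , q⊑r) ⟩
        count (q ⊑?_) (layer D)                ≡⟨ count-inside q D (ℕP.≤-trans (⊑-length q⊑s) s≤D) ⟩
        4 ^ (D ∸ length q)                     ∎))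
      (ℕP.^-monoʳ-≤ 4 (ℕP.∸-monoʳ-≤ D j≤q))

  spare-pixel : ∀ {U s V q} → Carries U s V → Clear U q → q ⊑ s → j ≤ₙ length q →
    Σ Pixel λ a → Clear V a × length a ≡ L × ¬ q ⊑ a
  spare-pixel {V = V} {q = q} c clear-q q⊑s j≤q
    with count-witness (clear? V ∩? ∁? (q ⊑?_)) (layer-length D) (empty-outside c clear-q q⊑s j≤q)
  ... | r , (clear-r , q⋢r) , r-layer =
    take L r , clear-ancestor L r (carries-bounded c) clear-r L≤r , length-take r L≤r ,
    λ q⊑a → q⋢r (⊑-trans q⊑a (take-⊑ L r))
    where
    L≤r : L ≤ₙ length r
    L≤r = subst (L ≤ₙ_) (sym r-layer) L≤D

  shift-extra : ∀ {U s V a} → Carries U s V → Clear V a → length a ≡ L →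
    Σ Config λ V′ → Move V V′ × Carries U a V′
  shift-extra {U} {s} {V} {a} c clear-a a-layer = moveSquare V s a , mv , carry-move c mv (shallow c) a-layer ext′
    where
    mv : Move V (moveSquare V s a)
    mv = move-valid (extends-occupied (extra c)) clear-a (trans (s-layer c) (sym a-layer))
    without-s : ∀ r → (Occupied V r × r ≢ s) ⇔ Occupied U r
    without-s r = mk⇔ (λ (o , r≢s) → [ (λ o → o) , (λ r≡s → ⊥-elim (r≢s r≡s)) ] (V⊆U+s c r o))
      λ o → extends-⊆ (extra c) r o , λ { refl → no-ancestor (extra-clear (extra c)) r (⊑-refl r) o }
    ext′ : Extends U a (moveSquare V s a)
    ext′ = extends (clear-mono (extends-⊆ (extra c)) clear-a)
      λ r → ⇔.trans (move-spec clear-a r) (without-s r ⊎-⇔ ⇔.refl)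

  -- If a clear pixel q of U contains s and is larger than a j-pixel, then V already
  -- has an empty j-pixel: one inside q on a different branch from s.
  nested-exit : ∀ {U s V q} → Carries U s V → Clear U q → q ⊑ s → length q <ₙ j →
    Σ Pixel λ P → length P ≡ j × Empty V P
  nested-exit c clear-q ([] , s≡q) q<j = ⊥-elim (ℕP.<-irrefl refl (ℕP.<-trans q<j (subst (j <ₙ_) L≡q j<L)))
    where
    L≡q = trans (sym (s-layer c)) (cong length (trans s≡q (ListP.++-identityʳ _)))
  nested-exit {V = V} {q = q} c clear-q (k ∷ w , s≡q++kw) q<j =
    P , P-layer , clear⇒empty {V} (clear-add (V⊆U+s c) clear-P (P⋢s , s⋢P))
    where
    P = q ++ other k ∷ replicate (j ∸ suc (length q)) zero
    P-layer : length P ≡ j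
    P-layer = trans (ListP.length-++ q) (trans (cong (λ n → length q + suc n) (ListP.length-replicate _))
                (trans (ℕP.+-suc (length q) _) (ℕP.m+[n∸m]≡n q<j)))
    clear-P : Clear _ P
    clear-P = clear-inside clear-q (⊑-++ q _)
    P⋢s : ¬ P ⊑ _
    P⋢s P⊑s = branch-apart q (other≢ k) (subst (P ⊑_) s≡q++kw P⊑s)
    s⋢P : ¬ _ ⊑ P
    s⋢P s⊑P = branch-apart q (λ e → other≢ k (sym e)) (subst (_⊑ P) s≡q++kw s⊑P)

  make-room : ∀ {U s V q} → Carries U s V → Clear U q → length q ≤ₙ L →
    ReachesEmpty j V ⊎ Σ Config λ V′ → Star Move V V′ × Σ Pixel λ s′ → Carries U s′ V′ × Disjoint q s′
  make-room {U} {s} {V} {q} c clear-q q≤L with q ⊑? s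
  ... | no q⋢s =
    inj₂ (V , ε , s , c , q⋢s , λ s⊑q → q⋢s (⊑-flip s⊑q (subst (length q ≤ₙ_) (sym (s-layer c)) q≤L)))
  ... | yes q⊑s with j ≤ₙ? length q
  ...   | no  j≰q = inj₁ (V , ε , nested-exit c clear-q q⊑s (ℕP.≰⇒> j≰q))
  ...   | yes j≤q with spare-pixel c clear-q q⊑s j≤q
  ...     | a , clear-a , a-layer , q⋢a with shift-extra c clear-a a-layer
  ...       | V′ , mv , c′ =
    inj₂ (V′ , mv ◅ ε , a , c′ , q⋢a , λ a⊑q → q⋢a (⊑-flip a⊑q (subst (length q ≤ₙ_) (sym a-layer) q≤L)))

  replay-move : ∀ {U s V U′} → Carries U s V → ((p , q , _) : Move U U′) → Disjoint q s →
    Σ Config λ V′ → Move V V′ × Carries U′ s V′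
  replay-move {U} {s} {V} {U′} c (p , q , same-layer , occ-p , empty-q , U′-spec) (q⋢s , s⋢q) =
    moveSquare V p q , mv , carry-move c mv shallow′ (s-layer c) (extends s-clear′ occupancy′)
    where
    clear-q : Clear V q
    clear-q = clear-add (V⊆U+s c) (empty⇒clear {U} empty-q) (q⋢s , s⋢q)
    mv : Move V (moveSquare V p q)
    mv = move-valid (extends-⊆ (extra c) p occ-p) clear-q same-layer
    U′⊆U+q : ∀ r → Occupied U′ r → Occupied U r ⊎ r ≡ q
    U′⊆U+q r o = [ (λ (o , _) → inj₁ o) , inj₂ ] (Equivalence.to (U′-spec r) o)
    shallow′ : Bounded L U′
    shallow′ r o with U′⊆U+q r o
    ... | inj₁ occ-r = shallow c r occ-r
    ... | inj₂ refl  = subst (_≤ₙ L) same-layer (shallow c p occ-p)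
    s-clear′ : Clear U′ s
    s-clear′ = clear-add U′⊆U+q (extra-clear (extra c)) (s⋢q , q⋢s)
    s≢p : s ≢ p
    s≢p refl = no-ancestor (extra-clear (extra c)) s (⊑-refl s) occ-p
    occupancy′ : ∀ r → Occupied (moveSquare V p q) r ⇔ (Occupied U′ r ⊎ r ≡ s)
    occupancy′ r = ⇔.trans (move-spec clear-q r)
      (⇔.trans ((occupancy (extra c) r ×-⇔ ⇔.refl) ⊎-⇔ ⇔.refl)
        (⇔.trans (move-past s≢p) (⇔.sym (U′-spec r) ⊎-⇔ ⇔.refl)))

  evict : ∀ {U s V P} → Carries U s V → Clear U P → length P ≡ j → ReachesEmpty j V
  evict c clear-P P-layer with make-room c clear-P (subst (_≤ₙ L) (sym P-layer) (ℕP.<⇒≤ j<L))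
  ... | inj₁ done = done
  ... | inj₂ (V′ , V→V′ , s′ , c′ , P⋈s′) =
    V′ , V→V′ , _ , P-layer , clear⇒empty {V′} (clear-add (V⊆U+s c′) clear-P P⋈s′)

  replay-steps : ∀ {U s V U*} → Carries U s V → Star Move U U* → (Σ Pixel λ P → length P ≡ j × Empty U* P) →
    ReachesEmpty j V
  replay-steps {U} c ε (P , P-layer , empty-P) = evict c (empty⇒clear {U} empty-P) P-layer
  replay-steps {U} c (mv@(p , q , same-layer , occ-p , empty-q , _) ◅ rest) goal
    with make-room c (empty⇒clear {U} empty-q) (subst (_≤ₙ L) same-layer (shallow c p occ-p))
  ... | inj₁ done = done
  ... | inj₂ (V′ , V→V′ , s′ , c′ , q⋈s′) with replay-move c′ mv q⋈s′
  ...   | V″ , V′→V″ , c″ = prepend (V→V′ ◅◅ V′→V″ ◅ ε) (replay-steps c″ rest goal)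

  replay : ∀ {U s V} → Carries U s V → ReachesEmpty j U → ReachesEmpty j V
  replay c (_ , steps , goal) = replay-steps c steps goal

Deepest : (Pixel → Set) → Set
Deepest P = (∀ r → ¬ P r) ⊎ Σ Pixel λ s → P s × (∀ r → P r → length r ≤ₙ length s)

deepest-∪ : ∀ {P Q : Pixel → Set} → Deepest P → Deepest Q → Deepest (λ r → P r ⊎ Q r)
deepest-∪ (inj₁ no-P) (inj₁ no-Q) = inj₁ λ r → [ no-P r , no-Q r ]
deepest-∪ (inj₁ no-P) (inj₂ (s , qs , h)) = inj₂ (s , inj₂ qs , λ r → [ (λ p → ⊥-elim (no-P r p)) , h r ])
deepest-∪ (inj₂ (s , ps , h)) (inj₁ no-Q) = inj₂ (s , inj₁ ps , λ r → [ h r , (λ q → ⊥-elim (no-Q r q)) ])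
deepest-∪ (inj₂ (s , ps , h)) (inj₂ (s′ , qs′ , h′)) with length s ≤ₙ? length s′
... | yes s≤s′ = inj₂ (s′ , inj₂ qs′ , λ r → [ (λ p → ℕP.≤-trans (h r p) s≤s′) , h′ r ])
... | no  s≰s′ = inj₂ (s , inj₁ ps , λ r → [ h r , (λ q → ℕP.≤-trans (h′ r q) s′≤s) ])
  where
  s′≤s = ℕP.<⇒≤ (ℕP.≰⇒> s≰s′)

Below : Fin 4 → (Pixel → Set) → Pixel → Set
Below i P []      = ⊥
Below i P (k ∷ r) = k ≡ i × P r

deepest-below : ∀ {P} i → Deepest P → Deepest (Below i P)
deepest-below i (inj₁ no-P) = inj₁ λ { [] () ; (_ ∷ r) (_ , p) → no-P r p }
deepest-below i (inj₂ (s , ps , h)) = inj₂ (i ∷ s , (refl , ps) , λ { [] () ; (_ ∷ r) (_ , p) → s≤s (h r p) })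

deepest-⇔ : ∀ {P Q : Pixel → Set} → (∀ r → P r ⇔ Q r) → Deepest P → Deepest Q
deepest-⇔ P⇔Q (inj₁ no-P) = inj₁ λ r q → no-P r (Equivalence.from (P⇔Q r) q)
deepest-⇔ P⇔Q (inj₂ (s , ps , h)) =
  inj₂ (s , Equivalence.to (P⇔Q s) ps , λ r q → h r (Equivalence.from (P⇔Q r) q))

deepest : ∀ T → Deepest (Occupied T)
deepest emptyLeaf = inj₁ λ _ ()
deepest occLeaf   = inj₂ ([] , tt , λ { [] _ → z≤n ; (_ ∷ _) () })
deepest (node f)  =
  deepest-⇔ quadrants (deepest-∪ (below (# 0)) (deepest-∪ (below (# 1)) (deepest-∪ (below (# 2)) (below (# 3)))))
  where
  below : ∀ i → Deepest (Below i (Occupied (f i)))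
  below i = deepest-below i (deepest (f i))
  Quadrants : Pixel → Set
  Quadrants r = Below (# 0) (Occupied (f (# 0))) r ⊎ (Below (# 1) (Occupied (f (# 1))) r
                ⊎ (Below (# 2) (Occupied (f (# 2))) r ⊎ Below (# 3) (Occupied (f (# 3))) r))
  split : ∀ r → Occupied (node f) r → Quadrants r
  split (zero                   ∷ r) o = inj₁ (refl , o)
  split (suc zero               ∷ r) o = inj₂ (inj₁ (refl , o))
  split (suc (suc zero)         ∷ r) o = inj₂ (inj₂ (inj₁ (refl , o)))
  split (suc (suc (suc zero))   ∷ r) o = inj₂ (inj₂ (inj₂ (refl , o)))
  join : ∀ r → Quadrants r → Occupied (node f) r
  join (_ ∷ _) (inj₁ (refl , o))                 = o
  join (_ ∷ _) (inj₂ (inj₁ (refl , o)))          = o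
  join (_ ∷ _) (inj₂ (inj₂ (inj₁ (refl , o))))   = o
  join (_ ∷ _) (inj₂ (inj₂ (inj₂ (refl , o))))   = o
  quadrants : ∀ r → Quadrants r ⇔ Occupied (node f) r
  quadrants r = mk⇔ (join r) (split r)

bounding-layer : ∀ T → Σ ℕ λ d → Bounded d T
bounding-layer T with deepest T
... | inj₁ no-squares           = 0 , λ r o → ⊥-elim (no-squares r o)
... | inj₂ (s , _ , s-deepest)  = length s , s-deepest

already-empty : ∀ {j D T} → Bounded j T → j ≤ₙ D → 0 <ₙ emptyCount D T → ReachesEmpty j T
already-empty {j} {D} {T} shallow j≤D positive with count-witness (clear? T) (layer-length D) positive
... | r , clear-r , r-layer =
  T , ε , take j r , length-take r j≤r , clear⇒empty {T} (clear-ancestor j r shallow clear-r j≤r)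
  where
  j≤r : j ≤ₙ length r
  j≤r = subst (j ≤ₙ_) (sym r-layer) j≤D

some-empty : ∀ j D {T} → 4 ^ (D ∸ j) ≤ₙ emptyCount D T → 0 <ₙ emptyCount D T
some-empty j D = ℕP.<-≤-trans (ℕP.m^n>0 4 (D ∸ j))

-- Fuel bookkeeping for the induction: a gain of c ≥ 1 empty pixels pays for one step.
fuel-step : ∀ {a e c m} → a ≤ₙ e + suc m → 0 <ₙ c → a ≤ₙ (e + c) + m
fuel-step {a} {e} {c} {m} a≤ c>0 =
  ℕP.≤-trans a≤ (ℕP.≤-trans (ℕP.+-monoʳ-≤ e (ℕP.+-monoˡ-≤ m c>0))
                            (ℕP.≤-reflexive (sym (ℕP.+-assoc e c m))))

-- The main induction, on a fuel n ≥ 4^D - emptyCount D T (each square removal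
-- consumes fuel).  With no square deeper than layer j there is nothing to do.
-- Otherwise remove a deepest square s, solve the problem for the rest U by
-- induction, and replay the solution in T, carrying s along.
reach-empty : ∀ n {j D T} → Bounded D T → j ≤ₙ D → 4 ^ (D ∸ j) ≤ₙ emptyCount D T →
  4 ^ D ≤ₙ emptyCount D T + n → ReachesEmpty j T
remove-deepest : ∀ n {j D T s} → Bounded D T → j ≤ₙ D → 4 ^ (D ∸ j) ≤ₙ emptyCount D T →
  4 ^ D ≤ₙ emptyCount D T + n → Occupied T s → Bounded (length s) T → j <ₙ length s → ReachesEmpty j T

reach-empty n {j} {D} {T} bounded j≤D enough fuel with deepest T
... | inj₁ no-squares = already-empty (λ r o → ⊥-elim (no-squares r o)) j≤D (some-empty j D enough)
... | inj₂ (s , occ-s , s-deepest) with length s ≤ₙ? j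
...   | yes s≤j = already-empty (λ r o → ℕP.≤-trans (s-deepest r o) s≤j) j≤D (some-empty j D enough)
...   | no  s≰j = remove-deepest n bounded j≤D enough fuel occ-s s-deepest (ℕP.≰⇒> s≰j)

-- Without fuel there is no room for the square s: removing it would give more
-- than 4^D empty D-pixels.
remove-deepest zero {j} {D} {T} {s} bounded j≤D enough fuel occ-s s-deepest j<s =
  ⊥-elim (ℕP.<-irrefl refl (ℕP.<-≤-trans (ℕP.+-monoʳ-< (emptyCount D T) (ℕP.m^n>0 4 (D ∸ length s))) overfull))
  where
  overfull : emptyCount D T + 4 ^ (D ∸ length s) ≤ₙ emptyCount D T + 0
  overfull = ℕP.≤-trans (ℕP.≤-reflexive (sym (remove-gain D T s occ-s (bounded s occ-s))))
    (ℕP.≤-trans (emptyCount≤ D (remove T s)) fuel)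
remove-deepest (suc m) {j} {D} {T} {s} bounded j≤D enough fuel occ-s s-deepest j<s =
  replay (carries (λ r o → s-deepest r (remove-⊆ T s r o)) enough refl (remove-extends T s occ-s))
         (reach-empty m bounded-U j≤D enough-U fuel-U)
  where
  open Replay j D (length s) j<s (bounded s occ-s) using (carries; replay)
  U = remove T s
  gain = remove-gain D T s occ-s (bounded s occ-s)
  bounded-U : Bounded D U
  bounded-U r o = bounded r (remove-⊆ T s r o)
  enough-U : 4 ^ (D ∸ j) ≤ₙ emptyCount D U
  enough-U = ℕP.≤-trans enough (subst (emptyCount D T ≤ₙ_) (sym gain) (ℕP.m≤m+n _ _))
  fuel-U : 4 ^ D ≤ₙ emptyCount D U + m
  fuel-U = subst (λ e → 4 ^ D ≤ₙ e + m) (sym gain) (fuel-step fuel (ℕP.m^n>0 4 (D ∸ length s)))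

theorem1 : (j : ℕ) (T : Config) → quarterPow j ≤ cap T →
    Σ Config λ T* → Star Move T T* × Σ Pixel λ p → length p ≡ j × Empty T* p
theorem1 j T capacity =
  reach-empty (4 ^ D) bounded j≤D (capacity-bound j D T bounded j≤D capacity) (ℕP.m≤n+m (4 ^ D) _)
  where
  d = proj₁ (bounding-layer T)
  D = j + d
  j≤D : j ≤ₙ D
  j≤D = ℕP.m≤m+n j d
  bounded : Bounded D T
  bounded r o = ℕP.≤-trans (proj₂ (bounding-layer T) r o) (ℕP.m≤n+m d j)
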